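{- Let $t\ge 1$ be an integer and let $\mathcal{D}$ be a $t$-$(v,k,1)$ design with $k\geq 2t$. If $v\geq k+t$ and $t+1\leq h\leq k-t+1$, then the hypergraph $H_{\mathcal{D},h}$ is $t$-e.c.
   Context: A $t$-$(v,k,\lambda)$ design is a pair $\mathcal{D}=(V,\mathcal{B})$ where $V$ is a set of $v$ points and $\mathcal{B}$ is a collection of $k$-subsets of $V$ (blocks) such that every $t$-subset of $V$ is contained in exactly $\lambda$ blocks. For $3\le h\le k$, $H_{\mathcal{D},h}$ is the $h$-uniform hypergraph with vertex set $V$ whose edges are all $h$-subsets of the blocks of $\mathcal{D}$ (for each block $B$, all $\binom{k}{h}$ $h$-subsets of $B$ are edges). An $h$-uniform hypergraph $H$ is $n$-e.c.\ if for every set $S\subseteq V(H)$ with $|S|=n$ and every $T\subseteq S$, there is $X\subseteq V(H)\setminus S$ with $|X|=h-1$ such that $X\cup\{z\}$ is an edge for every $z\in T$ and $X\cup\{s\}$ is not an edge for every $s\in S\setminus T$. -}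

module Defs where

open import Data.Nat using (ℕ; _∸_)
open import Data.Fin using (Fin)
open import Data.Fin.Subset using (Subset; ∣_∣; _⊆_; _∈_; _∉_; _∪_; ⁅_⁆)
open import Data.Fin.Subset.Properties using (_⊆?_)
open import Data.List using (List; length; filter)
open import Data.List.Relation.Unary.All using (All)
open import Data.List.Relation.Unary.Any using (Any)
open import Data.Product using (Σ; _×_)
open import Relation.Binary.PropositionalEquality using (_≡_)
open import Relation.Nullary using (¬_)

blocksContaining : {v : ℕ} → List (Subset v) → Subset v → ℕ
blocksContaining blocks T = length (filter (T ⊆?_) blocks)

IsDesign : (t v k lam : ℕ) → List (Subset v) → Set
IsDesign t v k lam blocks =
  All (λ B → ∣ B ∣ ≡ k) blocks ×
  ((T : Subset v) → ∣ T ∣ ≡ t → blocksContaining blocks T ≡ lam)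

IsEdge : {v : ℕ} → List (Subset v) → ℕ → Subset v → Set
IsEdge blocks h E = ∣ E ∣ ≡ h × Any (λ B → E ⊆ B) blocks

Disjoint : {v : ℕ} → Subset v → Subset v → Set
Disjoint X S = (x : Fin _) → x ∈ X → x ∉ S

IsNEC : {v : ℕ} → (n h : ℕ) → (Subset v → Set) → Set
IsNEC {v} n h Edge =
  (S : Subset v) → ∣ S ∣ ≡ n → (T : Subset v) → T ⊆ S →
  Σ (Subset v) λ X →
    Disjoint X S × ∣ X ∣ ≡ h ∸ 1 ×
    ((z : Fin v) → z ∈ T → Edge (X ∪ ⁅ z ⁆)) ×
    ((s : Fin v) → s ∈ S → s ∉ T → ¬ Edge (X ∪ ⁅ s ⁆))

{-# OPTIONS --safe #-}
-- Choose a block B through T that misses S ─ T, and let X be h − 1 points of B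
-- outside S. Every X ∪ {z} with z ∈ T lies in B; and since |X| ≥ t, the only block
-- containing X ∪ {s} could be B, which misses s ∈ S ─ T. If T = S, take B to be the
-- block B₀ through S. Otherwise extend T by points of B₀ outside S to a (t − 1)-set
-- Q, and let B be the block through Q ∪ {c} for a point c ∉ B₀ (here k < v): if B
-- contained some s ∈ S ─ T, then Q ∪ {s} would be a t-set in both B and B₀, forcing
-- B = B₀ ∋ c.
module Submission where

open import Defs
open import Data.Nat using (ℕ; _≤_; _+_; _*_; _∸_)
open import Data.Fin.Subset using (Subset)
open import Data.List using (List)

open import Data.Nat using (zero; suc; pred; _<_; z≤n; s≤s; z<s; ≢-nonZero)
open import Data.Nat.Properties
open import Data.Fin using (Fin; zero; suc)
open import Data.Fin.Properties using (any?)
open import Data.Fin.Subset using (_∈_; _∉_; _⊆_; _∪_; _─_; ⁅_⁆; ∣_∣; ⊥; ⊤; inside; outside)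
open import Data.Fin.Subset.Properties
open import Data.Vec using (_∷_; []; here; there)
open import Data.List using (_∷_; []; length; filter)
open import Data.List.Membership.Propositional using (find; lose) renaming (_∈_ to _∈ₗ_)
open import Data.List.Membership.Propositional.Properties using (∈-filter⁺; ∈-filter⁻)
open import Data.List.Relation.Unary.All as All using ()
open import Data.List.Relation.Unary.Any using (here)
open import Data.Product using (∃; _×_; _,_; proj₁; proj₂)
open import Data.Sum using ([_,_])
open import Function using (_∘_)
open import Relation.Binary.PropositionalEquality using (_≡_; refl; sym; trans; cong; subst; subst₂)
open import Relation.Nullary using (¬_; yes; no; contradiction; ¬?; _×-dec_)
open import Relation.Nullary.Decidable using (decidable-stable)

private variable
  A : Set
  n m : ℕ
  p q : Subset n
  x : Fin n

length≡1⇒∃∈ : (xs : List A) → length xs ≡ 1 → ∃ λ x → x ∈ₗ xs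
length≡1⇒∃∈ (x ∷ []) _ = x , here refl

length≡1⇒∈-unique : (xs : List A) {x y : A} → length xs ≡ 1 → x ∈ₗ xs → y ∈ₗ xs → x ≡ y
length≡1⇒∈-unique (_ ∷ []) _ (here refl) (here refl) = refl

x∈p─q⇒x∉q : ∀ (p q : Subset n) → x ∈ p ─ q → x ∉ q
x∈p─q⇒x∉q (_ ∷ p) (_ ∷ q) (there x∈p─q) (there x∈q) = x∈p─q⇒x∉q p q x∈p─q x∈q

∣p∣≤∣q∣+∣p─q∣ : ∀ (p q : Subset n) → ∣ p ∣ ≤ ∣ q ∣ + ∣ p ─ q ∣
∣p∣≤∣q∣+∣p─q∣ []            []            = z≤n
∣p∣≤∣q∣+∣p─q∣ (inside  ∷ p) (inside  ∷ q) = s≤s (∣p∣≤∣q∣+∣p─q∣ p q)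
∣p∣≤∣q∣+∣p─q∣ (inside  ∷ p) (outside ∷ q) = ≤-trans (s≤s (∣p∣≤∣q∣+∣p─q∣ p q)) (≤-reflexive (sym (+-suc _ _)))
∣p∣≤∣q∣+∣p─q∣ (outside ∷ p) (inside  ∷ q) = m≤n⇒m≤1+n (∣p∣≤∣q∣+∣p─q∣ p q)
∣p∣≤∣q∣+∣p─q∣ (outside ∷ p) (outside ∷ q) = ∣p∣≤∣q∣+∣p─q∣ p q

∣p∣∸∣q∣≤∣p─q∣ : ∀ (p q : Subset n) → ∣ p ∣ ∸ ∣ q ∣ ≤ ∣ p ─ q ∣
∣p∣∸∣q∣≤∣p─q∣ p q = m≤n+o⇒m∸n≤o ∣ p ∣ ∣ q ∣ (∣p∣≤∣q∣+∣p─q∣ p q)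

x∉p⇒∣p∪⁅x⁆∣≡1+∣p∣ : ∀ (p : Subset n) x → x ∉ p → ∣ p ∪ ⁅ x ⁆ ∣ ≡ suc ∣ p ∣
x∉p⇒∣p∪⁅x⁆∣≡1+∣p∣ (outside ∷ p) zero    _   = cong (suc ∘ ∣_∣) (∪-identityʳ p)
x∉p⇒∣p∪⁅x⁆∣≡1+∣p∣ (inside  ∷ p) zero    x∉p = contradiction here x∉p
x∉p⇒∣p∪⁅x⁆∣≡1+∣p∣ (outside ∷ p) (suc x) x∉p = x∉p⇒∣p∪⁅x⁆∣≡1+∣p∣ p x (x∉p ∘ there)
x∉p⇒∣p∪⁅x⁆∣≡1+∣p∣ (inside  ∷ p) (suc x) x∉p = cong suc (x∉p⇒∣p∪⁅x⁆∣≡1+∣p∣ p x (x∉p ∘ there))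

p⊆q∧x∈q⇒p∪⁅x⁆⊆q : p ⊆ q → x ∈ q → p ∪ ⁅ x ⁆ ⊆ q
p⊆q∧x∈q⇒p∪⁅x⁆⊆q {p = p} {x = x} p⊆q x∈q y∈p∪⁅x⁆ =
  [ p⊆q , (λ y∈⁅x⁆ → subst (_∈ _) (sym (x∈⁅y⁆⇒x≡y x y∈⁅x⁆)) x∈q) ] (x∈p∪q⁻ p ⁅ x ⁆ y∈p∪⁅x⁆)

∣p∣<∣q∣⇒∃∈q∉p : ∀ (p q : Subset n) → ∣ p ∣ < ∣ q ∣ → ∃ λ x → x ∈ q × x ∉ p
∣p∣<∣q∣⇒∃∈q∉p p q ∣p∣<∣q∣ with any? (λ x → x ∈? q ×-dec ¬? (x ∈? p))
... | yes found = found
... | no  none  = contradiction (p⊆q⇒∣p∣≤∣q∣ q⊆p) (<⇒≱ ∣p∣<∣q∣)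
  where
  q⊆p : q ⊆ p
  q⊆p {x} x∈q = decidable-stable (x ∈? p) (λ x∉p → none (x , x∈q , x∉p))

⊆-grow : ∀ (p q : Subset n) → p ⊆ q → ∣ p ∣ < ∣ q ∣ → ∃ λ r → p ⊆ r × r ⊆ q × ∣ r ∣ ≡ suc ∣ p ∣
⊆-grow p q p⊆q ∣p∣<∣q∣ with x , x∈q , x∉p ← ∣p∣<∣q∣⇒∃∈q∉p p q ∣p∣<∣q∣ =
  p ∪ ⁅ x ⁆ , p⊆p∪q ⁅ x ⁆ , p⊆q∧x∈q⇒p∪⁅x⁆⊆q {p = p} p⊆q x∈q , x∉p⇒∣p∪⁅x⁆∣≡1+∣p∣ p x x∉p

⊆-extend-by : ∀ d → p ⊆ q → ∣ p ∣ + d ≡ m → m ≤ ∣ q ∣ → ∃ λ r → p ⊆ r × r ⊆ q × ∣ r ∣ ≡ m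
⊆-extend-by {p = p} zero p⊆q ∣p∣+0≡m _ = p , ⊆-refl , p⊆q , trans (sym (+-identityʳ ∣ p ∣)) ∣p∣+0≡m
⊆-extend-by {p = p} {q = q} (suc d) p⊆q ∣p∣+1+d≡m m≤∣q∣
  with p′ , p⊆p′ , p′⊆q , ∣p′∣≡1+∣p∣ ← ⊆-grow p q p⊆q
           (<-≤-trans (m<m+n ∣ p ∣ z<s) (subst (_≤ ∣ q ∣) (sym ∣p∣+1+d≡m) m≤∣q∣))
  with r , p′⊆r , r⊆q , ∣r∣≡m ← ⊆-extend-by d p′⊆q
           (trans (cong (_+ d) ∣p′∣≡1+∣p∣) (trans (sym (+-suc ∣ p ∣ d)) ∣p∣+1+d≡m)) m≤∣q∣
  = r , p′⊆r ∘ p⊆p′ , r⊆q , ∣r∣≡m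

⊆-extend : p ⊆ q → ∣ p ∣ ≤ m → m ≤ ∣ q ∣ → ∃ λ r → p ⊆ r × r ⊆ q × ∣ r ∣ ≡ m
⊆-extend {p = p} {m = m} p⊆q ∣p∣≤m = ⊆-extend-by (m ∸ ∣ p ∣) p⊆q (m+[n∸m]≡n ∣p∣≤m)

subset-of-size : ∀ {n m} {q : Subset n} → m ≤ ∣ q ∣ → ∃ λ r → r ⊆ q × ∣ r ∣ ≡ m
subset-of-size {n = n} {q = q} m≤∣q∣
  with r , _ , r⊆q , ∣r∣≡m ← ⊆-extend {p = ⊥} {q = q} ⊥⊆ (subst (_≤ _) (sym (∣⊥∣≡0 n)) z≤n) m≤∣q∣
  = r , r⊆q , ∣r∣≡m

module SteinerSystem {t v k : ℕ} {blocks : List (Subset v)} (design : IsDesign t v k 1 blocks) where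

  private variable
    h : ℕ
    s c : Fin v
    B B′ E P Q S T X : Subset v

  ∣block∣≡k : B ∈ₗ blocks → ∣ B ∣ ≡ k
  ∣block∣≡k = All.lookup (proj₁ design)

  block-through : ∣ T ∣ ≡ t → ∃ λ B → B ∈ₗ blocks × T ⊆ B
  block-through {T} ∣T∣≡t with B , B∈ ← length≡1⇒∃∈ (filter (T ⊆?_) blocks) (proj₂ design T ∣T∣≡t) =
    B , ∈-filter⁻ (T ⊆?_) B∈

  block-unique : t ≤ ∣ X ∣ → B ∈ₗ blocks → X ⊆ B → B′ ∈ₗ blocks → X ⊆ B′ → B ≡ B′
  block-unique t≤∣X∣ B∈ X⊆B B′∈ X⊆B′ with T , T⊆X , ∣T∣≡t ← subset-of-size t≤∣X∣ =
    length≡1⇒∈-unique (filter (T ⊆?_) blocks) (proj₂ design T ∣T∣≡t)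
      (∈-filter⁺ (T ⊆?_) B∈ (X⊆B ∘ T⊆X)) (∈-filter⁺ (T ⊆?_) B′∈ (X⊆B′ ∘ T⊆X))

  k∸t≤∣B─P∣ : B ∈ₗ blocks → ∣ P ∣ ≤ t → k ∸ t ≤ ∣ B ─ P ∣
  k∸t≤∣B─P∣ {B} {P} B∈ ∣P∣≤t = ≤-trans (∸-monoʳ-≤ k ∣P∣≤t)
    (subst (λ m → m ∸ ∣ P ∣ ≤ ∣ B ─ P ∣) (∣block∣≡k B∈) (∣p∣∸∣q∣≤∣p─q∣ B P))

  edge⊆block : t ≤ ∣ X ∣ → B ∈ₗ blocks → X ⊆ B → X ⊆ E → IsEdge blocks h E → E ⊆ B
  edge⊆block t≤∣X∣ B∈ X⊆B X⊆E (_ , E⊆some) with B′ , B′∈ , E⊆B′ ← find E⊆some =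
    subst (_ ⊆_) (sym (block-unique t≤∣X∣ B∈ X⊆B B′∈ (E⊆B′ ∘ X⊆E))) E⊆B′

  block-through-⁅c⁆-meets-only-in : suc ∣ Q ∣ ≡ t → B ∈ₗ blocks → Q ⊆ B → c ∉ B →
                                     B′ ∈ₗ blocks → Q ∪ ⁅ c ⁆ ⊆ B′ → s ∉ Q → s ∈ B → s ∉ B′
  block-through-⁅c⁆-meets-only-in {Q} {B} {c} {B′} {s} 1+∣Q∣≡t B∈ Q⊆B c∉B B′∈ Q∪⁅c⁆⊆B′ s∉Q s∈B s∈B′ =
    c∉B (subst (c ∈_) (sym B≡B′) (Q∪⁅c⁆⊆B′ (q⊆p∪q Q ⁅ c ⁆ (x∈⁅x⁆ c))))
    where
    B≡B′ : B ≡ B′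
    B≡B′ = block-unique (≤-reflexive (sym (trans (x∉p⇒∣p∪⁅x⁆∣≡1+∣p∣ Q s s∉Q) 1+∣Q∣≡t)))
      B∈ (p⊆q∧x∈q⇒p∪⁅x⁆⊆q Q⊆B s∈B) B′∈ (p⊆q∧x∈q⇒p∪⁅x⁆⊆q (Q∪⁅c⁆⊆B′ ∘ p⊆p∪q ⁅ c ⁆) s∈B′)

  private
    separating-block-⊂ : pred t ≤ k ∸ t → k < v → B ∈ₗ blocks → S ⊆ B → ∣ S ∣ ≡ t → T ⊆ S → ∣ T ∣ < t →
                         ∃ λ B′ → B′ ∈ₗ blocks × T ⊆ B′ × (∀ {s} → s ∈ S → s ∉ T → s ∉ B′)
    separating-block-⊂ {B} {S} {T} pred[t]≤k∸t k<v B∈ S⊆B ∣S∣≡t T⊆S ∣T∣<t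
      = let c , _ , c∉B = ∣p∣<∣q∣⇒∃∈q∉p B ⊤ ∣B∣<∣⊤∣
            Q , T⊆Q , Q⊆B─[S─T] , ∣Q∣≡pred[t] = ⊆-extend T⊆B─[S─T] (<⇒≤pred ∣T∣<t) pred[t]≤∣B─[S─T]∣
            Q⊆B : Q ⊆ B
            Q⊆B = p─q⊆p B (S ─ T) ∘ Q⊆B─[S─T]
            1+∣Q∣≡t : suc ∣ Q ∣ ≡ t
            1+∣Q∣≡t = trans (cong suc ∣Q∣≡pred[t]) (suc-pred t ⦃ ≢-nonZero (m<n⇒n≢0 ∣T∣<t) ⦄)
            B′ , B′∈ , Q∪⁅c⁆⊆B′ = block-through (trans (x∉p⇒∣p∪⁅x⁆∣≡1+∣p∣ Q c (c∉B ∘ Q⊆B)) 1+∣Q∣≡t)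
        in B′ , B′∈ , Q∪⁅c⁆⊆B′ ∘ p⊆p∪q ⁅ c ⁆ ∘ T⊆Q , λ s∈S s∉T →
             block-through-⁅c⁆-meets-only-in 1+∣Q∣≡t B∈ Q⊆B c∉B B′∈ Q∪⁅c⁆⊆B′
               (λ s∈Q → x∈p─q⇒x∉q B (S ─ T) (Q⊆B─[S─T] s∈Q) (x∈p∧x∉q⇒x∈p─q s∈S s∉T)) (S⊆B s∈S)
      where
      ∣B∣<∣⊤∣ : ∣ B ∣ < ∣ ⊤ {v} ∣
      ∣B∣<∣⊤∣ = subst₂ _<_ (sym (∣block∣≡k B∈)) (sym (∣⊤∣≡n v)) k<v
      T⊆B─[S─T] : T ⊆ B ─ (S ─ T)
      T⊆B─[S─T] x∈T = x∈p∧x∉q⇒x∈p─q (S⊆B (T⊆S x∈T)) (λ x∈S─T → x∈p─q⇒x∉q S T x∈S─T x∈T)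
      pred[t]≤∣B─[S─T]∣ : pred t ≤ ∣ B ─ (S ─ T) ∣
      pred[t]≤∣B─[S─T]∣ = ≤-trans pred[t]≤k∸t (k∸t≤∣B─P∣ B∈ (≤-trans (∣p─q∣≤∣p∣ S T) (≤-reflexive ∣S∣≡t)))

  separating-block : pred t ≤ k ∸ t → k < v → ∣ S ∣ ≡ t → T ⊆ S →
                     ∃ λ B → B ∈ₗ blocks × T ⊆ B × (∀ {s} → s ∈ S → s ∉ T → s ∉ B)
  separating-block {S} {T} pred[t]≤k∸t k<v ∣S∣≡t T⊆S with block-through ∣S∣≡t | ∣ T ∣ <? t
  ... | B , B∈ , S⊆B | yes ∣T∣<t = separating-block-⊂ pred[t]≤k∸t k<v B∈ S⊆B ∣S∣≡t T⊆S ∣T∣<t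
  ... | B , B∈ , S⊆B | no  ∣T∣≮t = B , B∈ , S⊆B ∘ T⊆S , λ s∈S s∉T _ →
    ∣T∣≮t (subst (∣ T ∣ <_) ∣S∣≡t (p⊂q⇒∣p∣<∣q∣ (T⊆S , _ , s∈S , s∉T)))

  hypergraph-isNEC : ∀ {h} → pred t ≤ k ∸ t → k < v → t < h → h ≤ suc (k ∸ t) → IsNEC t h (IsEdge blocks h)
  hypergraph-isNEC {suc h} pred[t]≤k∸t k<v (s≤s t≤h) (s≤s h≤k∸t) S ∣S∣≡t T T⊆S
    with separating-block pred[t]≤k∸t k<v ∣S∣≡t T⊆S
  ... | B , B∈ , T⊆B , B-misses-S─T
    with subset-of-size {q = B ─ S} (≤-trans h≤k∸t (k∸t≤∣B─P∣ B∈ (≤-reflexive ∣S∣≡t)))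
  ... | X , X⊆B─S , ∣X∣≡h = X , X-disjoint-S , ∣X∣≡h , edge , non-edge
    where
    X⊆B : X ⊆ B
    X⊆B = p─q⊆p B S ∘ X⊆B─S
    X-disjoint-S : Disjoint X S
    X-disjoint-S x x∈X = x∈p─q⇒x∉q B S (X⊆B─S x∈X)
    edge : (z : Fin v) → z ∈ T → IsEdge blocks (suc h) (X ∪ ⁅ z ⁆)
    edge z z∈T = trans (x∉p⇒∣p∪⁅x⁆∣≡1+∣p∣ X z (λ z∈X → X-disjoint-S z z∈X (T⊆S z∈T))) (cong suc ∣X∣≡h)
               , lose B∈ (p⊆q∧x∈q⇒p∪⁅x⁆⊆q X⊆B (T⊆B z∈T))
    non-edge : (s : Fin v) → s ∈ S → s ∉ T → ¬ IsEdge blocks (suc h) (X ∪ ⁅ s ⁆)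
    non-edge s s∈S s∉T X∪⁅s⁆-edge = B-misses-S─T s∈S s∉T
      (edge⊆block (subst (t ≤_) (sym ∣X∣≡h) t≤h) B∈ X⊆B (p⊆p∪q ⁅ s ⁆) X∪⁅s⁆-edge (q⊆p∪q X ⁅ s ⁆ (x∈⁅x⁆ s)))

theorem11 : (t v k h : ℕ) (blocks : List (Subset v)) →
    1 ≤ t → IsDesign t v k 1 blocks → 2 * t ≤ k →
    k + t ≤ v → 3 ≤ h → t + 1 ≤ h → h ≤ (k ∸ t) + 1 →
    IsNEC t h (IsEdge blocks h)
theorem11 t v k h blocks 1≤t design 2t≤k k+t≤v _ t+1≤h h≤k∸t+1 =
  hypergraph-isNEC pred[t]≤k∸t k<v
    (subst (_≤ h) (+-comm t 1) t+1≤h) (subst (h ≤_) (+-comm (k ∸ t) 1) h≤k∸t+1)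
  where
  open SteinerSystem design
  pred[t]≤k∸t : pred t ≤ k ∸ t
  pred[t]≤k∸t = ≤-trans pred[n]≤n (m+n≤o⇒m≤o∸n t (subst (λ m → t + m ≤ k) (+-identityʳ t) 2t≤k))
  k<v : k < v
  k<v = <-≤-trans (m<m+n k 1≤t) k+t≤v
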